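{- Let $U$ be a finite set and $f(S)=|S|^3$ for $S\subseteq U$. Then $f$ is weakly submodular.
   Context: A normalized ($f(\emptyset)=0$), non-negative set function $f$ on a finite universe $U$ is called weakly submodular if for all $S,T\subseteq U$: $|T|f(S)+|S|f(T)\ge |S\cap T|\,f(S\cup T)+|S\cup T|\,f(S\cap T)$. -}

module Defs where

open import Data.Nat using (ℕ; _+_; _*_; _≥_; _^_)
open import Data.Fin.Subset using (Subset; ⊥; _∩_; _∪_; ∣_∣)
open import Relation.Binary.PropositionalEquality using (_≡_)
open import Data.Product using (_×_)

-- A set function on the finite universe Fin n, with values in ℕ
-- (so non-negativity is built in).
SetFn : ℕ → Set
SetFn n = Subset n → ℕ

Normalized : ∀ {n} → SetFn n → Set
Normalized f = f ⊥ ≡ 0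

WeakSubmodularIneq : ∀ {n} → SetFn n → Set
WeakSubmodularIneq f = ∀ S T →
  ∣ T ∣ * f S + ∣ S ∣ * f T ≥ ∣ S ∩ T ∣ * f (S ∪ T) + ∣ S ∪ T ∣ * f (S ∩ T)

WeaklySubmodular : ∀ {n} → SetFn n → Set
WeaklySubmodular f = Normalized f × WeakSubmodularIneq f

cubeCard : ∀ {n} → SetFn n
cubeCard S = ∣ S ∣ ^ 3

-- Write |S| = c + a, |T| = c + b, |S ∩ T| = c, so |S ∪ T| = c + a + b by inclusion–exclusion.
-- Expanding both sides of the inequality, the left side exceeds the right side by
-- exactly a b (a² + b²) ≥ 0.
module Submission where

open import Defs
open import Data.Nat using (ℕ; suc; _+_; _*_; _^_; _≤_)
open import Data.Nat.Properties using (+-suc; +-cancelʳ-≡; m≤m+n; m≤n⇒∃[o]m+o≡n)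
open import Data.Nat.Solver using (module +-*-Solver)
open import Data.Fin.Subset using (Subset; _∩_; _∪_; ∣_∣; inside; outside)
open import Data.Fin.Subset.Properties using (∣p∩q∣≤∣p∣; ∣p∩q∣≤∣q∣; ∣⊥∣≡0)
open import Data.Vec using (_∷_; [])
open import Data.Product using (_,_)
open import Function using (_∘_)
open import Relation.Binary.PropositionalEquality using (_≡_; refl; sym; trans; cong; module ≡-Reasoning)

∣p∪q∣+∣p∩q∣≡∣p∣+∣q∣ : ∀ {n} (p q : Subset n) → ∣ p ∪ q ∣ + ∣ p ∩ q ∣ ≡ ∣ p ∣ + ∣ q ∣
∣p∪q∣+∣p∩q∣≡∣p∣+∣q∣ []            []            = refl
∣p∪q∣+∣p∩q∣≡∣p∣+∣q∣ (inside  ∷ p) (inside  ∷ q) = begin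
  suc (∣ p ∪ q ∣ + suc ∣ p ∩ q ∣) ≡⟨ cong suc (+-suc ∣ p ∪ q ∣ ∣ p ∩ q ∣) ⟩
  suc (suc (∣ p ∪ q ∣ + ∣ p ∩ q ∣)) ≡⟨ cong (suc ∘ suc) (∣p∪q∣+∣p∩q∣≡∣p∣+∣q∣ p q) ⟩
  suc (suc (∣ p ∣ + ∣ q ∣))       ≡⟨ cong suc (+-suc ∣ p ∣ ∣ q ∣) ⟨
  suc (∣ p ∣ + suc ∣ q ∣)         ∎
  where open ≡-Reasoning
∣p∪q∣+∣p∩q∣≡∣p∣+∣q∣ (inside  ∷ p) (outside ∷ q) = cong suc (∣p∪q∣+∣p∩q∣≡∣p∣+∣q∣ p q)
∣p∪q∣+∣p∩q∣≡∣p∣+∣q∣ (outside ∷ p) (inside  ∷ q) =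
  trans (cong suc (∣p∪q∣+∣p∩q∣≡∣p∣+∣q∣ p q)) (sym (+-suc ∣ p ∣ ∣ q ∣))
∣p∪q∣+∣p∩q∣≡∣p∣+∣q∣ (outside ∷ p) (outside ∷ q) = ∣p∪q∣+∣p∩q∣≡∣p∣+∣q∣ p q

cube-excess : ∀ (a b c : ℕ) →
  (c + b) * (c + a) ^ 3 + (c + a) * (c + b) ^ 3
    ≡ (c * (c + a + b) ^ 3 + (c + a + b) * c ^ 3) + a * b * (a ^ 2 + b ^ 2)
cube-excess = solve 3 (λ a b c →
  (c :+ b) :* (c :+ a) :^ 3 :+ (c :+ a) :* (c :+ b) :^ 3
    := (c :* (c :+ a :+ b) :^ 3 :+ (c :+ a :+ b) :* c :^ 3) :+ a :* b :* (a :^ 2 :+ b :^ 2)) refl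
  where open +-*-Solver

regroup : ∀ (a b c : ℕ) → (c + a) + (c + b) ≡ (c + a + b) + c
regroup = solve 3 (λ a b c → (c :+ a) :+ (c :+ b) := (c :+ a :+ b) :+ c) refl
  where open +-*-Solver

cube-modular-ineq : ∀ {s t u c} → c ≤ s → c ≤ t → u + c ≡ s + t →
  c * u ^ 3 + u * c ^ 3 ≤ t * s ^ 3 + s * t ^ 3
cube-modular-ineq {u = u} {c} c≤s c≤t u+c≡s+t
  with a , refl ← m≤n⇒∃[o]m+o≡n c≤s
  with b , refl ← m≤n⇒∃[o]m+o≡n c≤t
  with refl ← +-cancelʳ-≡ c u (c + a + b) (trans u+c≡s+t (regroup a b c))
  rewrite cube-excess a b c = m≤m+n _ _

proposition8 : (n : ℕ) → WeaklySubmodular (cubeCard {n})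
proposition8 n = cong (_^ 3) (∣⊥∣≡0 n) , λ S T →
  cube-modular-ineq (∣p∩q∣≤∣p∣ S T) (∣p∩q∣≤∣q∣ S T) (∣p∪q∣+∣p∩q∣≡∣p∣+∣q∣ S T)
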